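{- Let $G=(V,E)$ be a graph, let $S$ be a maximal independent set of $G$, let $D$ be a 2-subset of $S$, and let $F(D)=\{v\in V\setminus S\mid N(v)\cap S\subseteq D\}$. If there is a vertex $v\in F(D)$ such that $(S\setminus D)\cup\{v\}$ is a maximal independent set of $G$, then $F(D)$ contains a 2-tight vertex.
   Context: $G=(V,E)$ is a simple undirected graph and $N(v)=\{u\mid uv\in E\}$. A 2-subset is a set of exactly two elements. For an independent set $S$ and a vertex $v\notin S$, the tightness of $v$ is $|N(v)\cap S|$, and $v$ is called $t$-tight if its tightness equals $t$. -}

module Defs where

open import Data.Nat using (ℕ)
open import Data.Bool using (Bool; true; false)
open import Data.Fin using (Fin)
open import Data.Fin.Subset using (Subset; _∈_; _∉_; _⊆_; _∩_; ∣_∣)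
open import Data.Vec using (tabulate)
open import Data.Product using (_×_)
open import Relation.Binary.PropositionalEquality using (_≡_)

record Graph (n : ℕ) : Set where
  field
    adj    : Fin n → Fin n → Bool
    sym    : ∀ u v → adj u v ≡ adj v u
    irrefl : ∀ v → adj v v ≡ false

open Graph public

module _ {n : ℕ} (G : Graph n) where

  N : Fin n → Subset n
  N v = tabulate (adj G v)

  Independent : Subset n → Set
  Independent S = ∀ u v → u ∈ S → v ∈ S → adj G u v ≡ false

  MaximalIndependent : Subset n → Set
  MaximalIndependent S =
    Independent S × (∀ T → Independent T → S ⊆ T → T ⊆ S)

  tightness : Subset n → Fin n → ℕ
  tightness S v = ∣ N v ∩ S ∣

  Tight : ℕ → Subset n → Fin n → Set
  Tight t S v = v ∉ S × tightness S v ≡ t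

  InF : Subset n → Subset n → Fin n → Set
  InF S D v = v ∉ S × (N v ∩ S) ⊆ D

module Submission where

-- The vertex v given by the hypothesis is itself the
-- required 2-tight vertex.  Write S' = (S ─ D) ∪ {v}.  Every x ∈ D must be
-- adjacent to v: otherwise x has no neighbour in S' (it has none in
-- S ─ D ⊆ S because S is independent, and it is not adjacent to v), and a
-- maximal independent set contains every vertex with no neighbour in it,
-- so x ∈ S' — impossible, since x ∈ D and x ≠ v (x ∈ S, v ∉ S).  Hence
-- D ⊆ N(v) ∩ S, and N(v) ∩ S ⊆ D because v ∈ F(D), so N(v) ∩ S = D and the
-- tightness of v is |D| = 2.

open import Defs
open import Data.Nat using (ℕ)
open import Data.Fin using (Fin)
open import Data.Fin.Subset using (Subset; _⊆_; _∪_; _─_; ⁅_⁆; ∣_∣; _∈_; _∉_; _∩_; inside; outside)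
open import Data.Fin.Subset.Properties using (x∈p∪q⁻; p⊆p∪q; q⊆p∪q; x∈⁅x⁆; x∈⁅y⁆⇒x≡y; x∈p∩q⁺; ⊆-antisym; p─q⊆p)
open import Data.Product using (Σ; _×_; _,_)
open import Data.Sum using (inj₁; inj₂)
open import Data.Bool using (true; false)
open import Data.Vec using (_∷_; there)
open import Data.Vec.Properties using (lookup⇒[]=; lookup∘tabulate)
open import Data.Empty using (⊥-elim)
open import Relation.Binary.PropositionalEquality using (_≡_; refl; trans; cong; subst)

x∈p─q⇒x∉q : ∀ {n} {x : Fin n} (p q : Subset n) → x ∈ p ─ q → x ∉ q
x∈p─q⇒x∉q (_ ∷ p) (outside ∷ q) (there x∈p─q) (there x∈q) = x∈p─q⇒x∉q p q x∈p─q x∈q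
x∈p─q⇒x∉q (_ ∷ p) (inside  ∷ q) (there x∈p─q) (there x∈q) = x∈p─q⇒x∉q p q x∈p─q x∈q

module _ {n : ℕ} (G : Graph n) where

  adj⇒∈N : ∀ {v x} → adj G v x ≡ true → x ∈ N G v
  adj⇒∈N {v} {x} vx = lookup⇒[]= x _ (trans (lookup∘tabulate (adj G v) x) vx)

  independent-∪⁅⁆ : ∀ {T x} → Independent G T →
    (∀ u → u ∈ T → adj G x u ≡ false) → Independent G (T ∪ ⁅ x ⁆)
  independent-∪⁅⁆ {T} {x} indT x⊥T u w u∈ w∈
    with x∈p∪q⁻ T ⁅ x ⁆ u∈ | x∈p∪q⁻ T ⁅ x ⁆ w∈
  ... | inj₁ u∈T | inj₁ w∈T = indT u w u∈T w∈T
  ... | inj₁ u∈T | inj₂ w≡x rewrite x∈⁅y⁆⇒x≡y x w≡x = trans (sym G u x) (x⊥T u u∈T)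
  ... | inj₂ u≡x | inj₁ w∈T rewrite x∈⁅y⁆⇒x≡y x u≡x = x⊥T w w∈T
  ... | inj₂ u≡x | inj₂ w≡x rewrite x∈⁅y⁆⇒x≡y x u≡x | x∈⁅y⁆⇒x≡y x w≡x = irrefl G x

  nonadjacent⇒∈ : ∀ {S x} → MaximalIndependent G S →
    (∀ u → u ∈ S → adj G x u ≡ false) → x ∈ S
  nonadjacent⇒∈ {S} {x} (indS , maxS) x⊥S =
    maxS (S ∪ ⁅ x ⁆) (independent-∪⁅⁆ indS x⊥S) (p⊆p∪q ⁅ x ⁆) (q⊆p∪q S ⁅ x ⁆ (x∈⁅x⁆ x))

  swapped-adjacent : ∀ {S D v} → Independent G S → D ⊆ S → v ∉ S →
    MaximalIndependent G ((S ─ D) ∪ ⁅ v ⁆) → ∀ {x} → x ∈ D → adj G v x ≡ true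
  swapped-adjacent {S} {D} {v} indS D⊆S v∉S maxS' {x} x∈D with adj G v x in vx
  ... | true  = refl
  ... | false = ⊥-elim (x∉S' (nonadjacent⇒∈ maxS' x⊥S'))
    where
    x⊥S' : ∀ u → u ∈ (S ─ D) ∪ ⁅ v ⁆ → adj G x u ≡ false
    x⊥S' u u∈S' with x∈p∪q⁻ (S ─ D) ⁅ v ⁆ u∈S'
    ... | inj₁ u∈S─D = indS x u (D⊆S x∈D) (p─q⊆p S D u∈S─D)
    ... | inj₂ u≡v rewrite x∈⁅y⁆⇒x≡y v u≡v = trans (sym G x v) vx

    x∉S' : x ∉ (S ─ D) ∪ ⁅ v ⁆
    x∉S' x∈S' with x∈p∪q⁻ (S ─ D) ⁅ v ⁆ x∈S'
    ... | inj₁ x∈S─D = x∈p─q⇒x∉q S D x∈S─D x∈D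
    ... | inj₂ x≡v   = v∉S (subst (_∈ S) (x∈⁅y⁆⇒x≡y v x≡v) (D⊆S x∈D))

  swapped-neighbourhood : ∀ {S D v} → Independent G S → D ⊆ S → InF G S D v →
    MaximalIndependent G ((S ─ D) ∪ ⁅ v ⁆) → N G v ∩ S ≡ D
  swapped-neighbourhood indS D⊆S (v∉S , NvS⊆D) maxS' =
    ⊆-antisym NvS⊆D
      (λ x∈D → x∈p∩q⁺ (adj⇒∈N (swapped-adjacent indS D⊆S v∉S maxS' x∈D) , D⊆S x∈D))

proposition4 : {n : ℕ} (G : Graph n) (S D : Subset n) →
    MaximalIndependent G S →
    D ⊆ S → ∣ D ∣ ≡ 2 →
    Σ (Fin n) (λ v → InF G S D v × MaximalIndependent G ((S ─ D) ∪ ⁅ v ⁆)) →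
    Σ (Fin n) (λ w → InF G S D w × Tight G 2 S w)
proposition4 G S D (indS , _) D⊆S ∣D∣≡2 (v , v∈F@(v∉S , _) , maxS') =
  v , v∈F , v∉S , trans (cong ∣_∣ (swapped-neighbourhood G indS D⊆S v∈F maxS')) ∣D∣≡2
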